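{- The functor $I^*:[\mathcal{C},\mathbf{Set}]\to\mathbf{01Sub}$ (defined in the context) is full: for all functors $F,F':\mathcal{C}\to\mathbf{Set}$ and every morphism $g:I^*F\to I^*F'$ in $\mathbf{01Sub}$, there is a natural transformation $\varphi:F\to F'$ with $I^*\varphi=g$.
   Context: Let $\mathbb{A}$ be a countably infinite set of names and $\mathrm{Perm}\,\mathbb{A}$ the group of finite permutations of $\mathbb{A}$ (permutations moving only finitely many names). A nominal set is a set $X$ with an action $(\pi,x)\mapsto \pi\cdot x$ of $\mathrm{Perm}\,\mathbb{A}$ such that every $x\in X$ has a finite support, i.e. a finite $A\subseteq\mathbb{A}$ such that every $\pi$ fixing each element of $A$ satisfies $\pi\cdot x=x$; $\mathrm{supp}\,x$ is the smallest such finite set, and $a\# x$ means $a\notin\mathrm{supp}\,x$. A function $f$ between nominal sets is equivariant if $f(\pi\cdot x)=\pi\cdot f(x)$. Let $2=\{0,1\}$ with trivial action, and $\mathbb{A}$ with action $\pi\cdot a=\pi(a)$. A $01$-substitution operation on a nominal set $X$ is an equivariant function $X\times\mathbb{A}\times 2\to X$, written $(x,a,i)\mapsto x(a:=i)$, such that for all $x\in X$, $a,a'\in\mathbb{A}$, $i,i'\in 2$: (i) $a\# x(a:=i)$; (ii) if $a\# x$ then $x(a:=i)=x$; (iii) if $a\neq a'$ then $x(a:=i)(a':=i')=x(a':=i')(a:=i)$. The category $\mathbf{01Sub}$ has as objects nominal sets equipped with a $01$-substitution operation, and as morphisms $X\to Y$ equivariant functions $f$ with $f(x(a:=i))=(f\,x)(a:=i)$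 for all $x,a,i$. The category $\mathcal{C}$ has as objects the finite subsets $A\subseteq\mathbb{A}$; a morphism $f\in\mathcal{C}(A,B)$ is a function $f:A\to B+2$ (disjoint union of $B$ and $\{0,1\}$) that is injective on $f^{ -1}B$. The identity on $A$ is $a\mapsto a$, and the composite of $f\in\mathcal{C}(A,B)$ and $g\in\mathcal{C}(B,C)$ is $(g\circ f)(a)=g(f(a))$ if $f(a)\in B$ and $(g\circ f)(a)=f(a)$ if $f(a)\in 2$. $[\mathcal{C},\mathbf{Set}]$ is the category of functors $\mathcal{C}\to\mathbf{Set}$ and natural transformations. For $A\subseteq B$ write $A\hookrightarrow B$ for the morphism $a\mapsto a$; for $\pi\in\mathrm{Perm}\,\mathbb{A}$ write $\pi|_A\in\mathcal{C}(A,\pi A)$ for $a\mapsto\pi(a)$; for $a\in\mathbb{A}$, $i\in 2$ let $f_{A,a,i}\in\mathcal{C}(A,A-\{a\})$ send $a$ to $i$ (if $a\in A$) and every $b\in A-\{a\}$ to $b$. The functor $I^*:[\mathcal{C},\mathbf{Set}]\to\mathbf{01Sub}$: for $F$, $I^*F$ is the set of equivalence classes $[A,x]$ of pairs with $A\in\mathcal{C}$, $x\in F\,A$, where $(A,x)\sim(A',x')$ iff there is a finite $B\supseteq A\cup A'$ with $F(A\hookrightarrow B)\,x=F(A'\hookrightarrow B)\,x'$; the action is $\pi\cdot[A,x]=[\pi A,F(\pi|_A)\,x]$ and the $01$-substitution is $[A,x](a:=i)=[A-\{a\},F(f_{A,a,i})\,x]$. For a natural transformation $\varphi:F\to F'$,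 $I^*\varphi[A,x]=[A,\varphi_A\,x]$. -}

module Defs where

open import Level using (0ℓ) renaming (suc to lsuc)
open import Data.Bool using (Bool; true; false; if_then_else_)
open import Data.Nat using (ℕ; zero; suc; _≟_)
open import Data.Nat.Properties using (suc-injective)
open import Data.List using (List; []; _∷_; _++_; map; foldr)
open import Data.List.Membership.Propositional using (_∈_)
open import Data.List.Membership.Propositional.Properties using (∈-++⁺ˡ; ∈-++⁺ʳ; ∈-map⁺)
open import Data.List.Relation.Unary.Any using (here; there)
open import Data.Sum using (_⊎_; inj₁; inj₂)
open import Data.Sum.Properties using (inj₁-injective)
open import Data.Product using (Σ; _×_; _,_; proj₁; proj₂)
open import Relation.Nullary using (¬_; yes; no)
open import Relation.Binary using (Rel; IsEquivalence)
open import Relation.Binary.PropositionalEquality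
  using (_≡_; _≢_; refl; sym; trans; cong; subst)

Name : Set
Name = ℕ

record Perm : Set where
  field
    π      : Name → Name
    π⁻¹    : Name → Name
    left   : ∀ a → π⁻¹ (π a) ≡ a
    right  : ∀ a → π (π⁻¹ a) ≡ a
    moved  : List Name
    finite : ∀ a → ¬ (a ∈ moved) → π a ≡ a
open Perm public using () renaming (π to ⟦_⟧)

idP : Perm
idP = record { π = λ a → a ; π⁻¹ = λ a → a ; left = λ _ → refl ; right = λ _ → refl
             ; moved = [] ; finite = λ _ _ → refl }

_∘P_ : Perm → Perm → Perm
p ∘P q = record
  { π = λ a → P.π p (P.π q a)
  ; π⁻¹ = λ a → P.π⁻¹ q (P.π⁻¹ p a)
  ; left = λ a → trans (cong (P.π⁻¹ q) (P.left p (P.π q a))) (P.left q a)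
  ; right = λ a → trans (cong (P.π p) (P.right q (P.π⁻¹ p a))) (P.right p a)
  ; moved = P.moved q ++ P.moved p
  ; finite = λ a a∉ → trans (cong (P.π p) (P.finite q a (λ i → a∉ (∈-++⁺ˡ i))))
                            (P.finite p a (λ i → a∉ (∈-++⁺ʳ (P.moved q) i)))
  }
  where module P = Perm

-- Finite subsets of 𝔸, canonically represented as bit lists without
-- trailing 'false' (so equal subsets are equal as Agda values).

cons : Bool → List Bool → List Bool
cons false [] = []
cons b l = b ∷ l

trim : List Bool → List Bool
trim [] = []
trim (b ∷ l) = cons b (trim l)

trim-cons : ∀ b l → trim (cons b l) ≡ cons b (trim l)
trim-cons false [] = refl
trim-cons false (c ∷ l) = refl
trim-cons true l = refl

trim-idem : ∀ l → trim (trim l) ≡ trim l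
trim-idem [] = refl
trim-idem (b ∷ l) = trans (trim-cons b (trim l)) (cong (cons b) (trim-idem l))

record FinSub : Set where
  constructor fs
  field
    bits  : List Bool
    canon : trim bits ≡ bits
open FinSub public

mkFS : List Bool → FinSub
mkFS l = fs (trim l) (trim-idem l)

mem : List Bool → Name → Bool
mem [] _ = false
mem (b ∷ l) zero = b
mem (b ∷ l) (suc n) = mem l n

_∈ₛ_ : Name → FinSub → Set
a ∈ₛ A = mem (bits A) a ≡ true

_⊆ₛ_ : FinSub → FinSub → Set
A ⊆ₛ B = ∀ a → a ∈ₛ A → a ∈ₛ B

mem-cons : ∀ b l n → mem (cons b l) n ≡ mem (b ∷ l) n
mem-cons false [] zero = refl
mem-cons false [] (suc n) = refl
mem-cons false (c ∷ l) n = refl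
mem-cons true l n = refl

mem-trim : ∀ l n → mem (trim l) n ≡ mem l n
mem-trim [] n = refl
mem-trim (b ∷ l) n = trans (mem-cons b (trim l) n) (go n)
  where
  go : ∀ n → mem (b ∷ trim l) n ≡ mem (b ∷ l) n
  go zero = refl
  go (suc n) = mem-trim l n

set : List Bool → Name → Bool → List Bool
set [] zero b = b ∷ []
set [] (suc n) b = false ∷ set [] n b
set (c ∷ l) zero b = b ∷ l
set (c ∷ l) (suc n) b = c ∷ set l n b

mem-set-same : ∀ l n b → mem (set l n b) n ≡ b
mem-set-same [] zero b = refl
mem-set-same [] (suc n) b = mem-set-same [] n b
mem-set-same (c ∷ l) zero b = refl
mem-set-same (c ∷ l) (suc n) b = mem-set-same l n b

mem-set-other : ∀ l n b m → m ≢ n → mem (set l n b) m ≡ mem l m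
mem-set-other [] zero b zero ne with ne refl
... | ()
mem-set-other [] zero b (suc m) ne = mem-[] m
  where
  mem-[] : ∀ m → mem [] m ≡ false
  mem-[] _ = refl
mem-set-other [] (suc n) b zero ne = refl
mem-set-other [] (suc n) b (suc m) ne = mem-set-other [] n b m (λ e → ne (cong suc e))
mem-set-other (c ∷ l) zero b zero ne with ne refl
... | ()
mem-set-other (c ∷ l) zero b (suc m) ne = refl
mem-set-other (c ∷ l) (suc n) b zero ne = refl
mem-set-other (c ∷ l) (suc n) b (suc m) ne = mem-set-other l n b m (λ e → ne (cong suc e))

mem-set-true : ∀ l n m → mem l m ≡ true → mem (set l n true) m ≡ true
mem-set-true l n m h with m ≟ n
... | yes refl = mem-set-same l n true
... | no ne = trans (mem-set-other l n true m ne) h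

elems : List Bool → List Name
elems [] = []
elems (b ∷ l) = (if b then 0 ∷ [] else []) ++ map suc (elems l)

elems-complete : ∀ l a → mem l a ≡ true → a ∈ elems l
elems-complete (true ∷ l) zero h = here refl
elems-complete (false ∷ l) zero ()
elems-complete (true ∷ l) (suc a) h = ∈-++⁺ʳ (0 ∷ []) (∈-map⁺ suc (elems-complete l a h))
elems-complete (false ∷ l) (suc a) h = ∈-map⁺ suc (elems-complete l a h)

remove : FinSub → Name → FinSub
remove A a = mkFS (set (bits A) a false)

remove-keeps : ∀ A a b → b ∈ₛ A → b ≢ a → b ∈ₛ remove A a
remove-keeps A a b h ne =
  trans (mem-trim (set (bits A) a false) b) (trans (mem-set-other (bits A) a false b ne) h)

imgList : (Name → Name) → List Name → List Bool
imgList f = foldr (λ a r → set r (f a) true) []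

imgList-∈ : ∀ f xs a → a ∈ xs → mem (imgList f xs) (f a) ≡ true
imgList-∈ f (x ∷ xs) a (here refl) = mem-set-same (imgList f xs) (f x) true
imgList-∈ f (x ∷ xs) a (there i) = mem-set-true (imgList f xs) (f x) (f a) (imgList-∈ f xs a i)

image : Perm → FinSub → FinSub
image p A = mkFS (imgList ⟦ p ⟧ (elems (bits A)))

image-∈ : ∀ p A a → a ∈ₛ A → ⟦ p ⟧ a ∈ₛ image p A
image-∈ p A a h =
  trans (mem-trim (imgList ⟦ p ⟧ (elems (bits A))) (⟦ p ⟧ a))
        (imgList-∈ ⟦ p ⟧ (elems (bits A)) a (elems-complete (bits A) a h))

-- A morphism f ∈ 𝒞(A,B), i.e. f : A → B + 2 injective on
-- f⁻¹B, is represented by a function ℕ → ℕ ⊎ Bool whose values on A land in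
-- B + 2; its values outside A are irrelevant (two morphisms are equal iff
-- they agree on A, see _≈H_).

record Hom (A B : FinSub) : Set where
  field
    fun  : Name → Name ⊎ Bool
    into : ∀ a → a ∈ₛ A → ∀ b → fun a ≡ inj₁ b → b ∈ₛ B
    inj  : ∀ a a' b → a ∈ₛ A → a' ∈ₛ A → fun a ≡ inj₁ b → fun a' ≡ inj₁ b → a ≡ a'
open Hom public

_≈H_ : ∀ {A B} → Hom A B → Hom A B → Set
_≈H_ {A} f g = ∀ a → a ∈ₛ A → fun f a ≡ fun g a

idH : ∀ A → Hom A A
idH A = record { fun = inj₁ ; into = λ { a h .a refl → h } ; inj = λ { a a' b _ _ refl refl → refl } }

bind : (Name → Name ⊎ Bool) → Name ⊎ Bool → Name ⊎ Bool
bind g (inj₁ b) = g b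
bind g (inj₂ i) = inj₂ i

_∘H_ : ∀ {A B C} → Hom B C → Hom A B → Hom A C
_∘H_ {A} {B} {C} g f = record { fun = λ a → bind (fun g) (fun f a) ; into = cin ; inj = cinj }
  where
  cin : ∀ a → a ∈ₛ A → ∀ c → bind (fun g) (fun f a) ≡ inj₁ c → c ∈ₛ C
  cin a h c eq with fun f a in e
  cin a h c eq | inj₁ b = into g b (into f a h b e) c eq
  cin a h c () | inj₂ i

  cinj : ∀ a a' c → a ∈ₛ A → a' ∈ₛ A → bind (fun g) (fun f a) ≡ inj₁ c
       → bind (fun g) (fun f a') ≡ inj₁ c → a ≡ a'
  cinj a a' c h h' eq eq' with fun f a in e | fun f a' in e'
  cinj a a' c h h' eq eq' | inj₁ b | inj₁ b' with inj g b b' c (into f a h b e) (into f a' h' b' e') eq eq'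
  ... | refl = inj f a a' b h h' e e'
  cinj a a' c h h' () eq' | inj₂ i | _
  cinj a a' c h h' eq () | inj₁ b | inj₂ i

incl : ∀ {A B} → A ⊆ₛ B → Hom A B
incl p = record { fun = inj₁ ; into = λ { a h .a refl → p a h } ; inj = λ { a a' b _ _ refl refl → refl } }

restrict : ∀ p A → Hom A (image p A)
restrict p A = record
  { fun = λ a → inj₁ (⟦ p ⟧ a)
  ; into = λ { a h .(⟦ p ⟧ a) refl → image-∈ p A a h }
  ; inj = λ { a a' b _ _ refl e' →
      trans (sym (Perm.left p a)) (trans (cong (Perm.π⁻¹ p) (sym (inj₁-injective e'))) (Perm.left p a')) }
  }

fsubFun : Name → Bool → Name → Name ⊎ Bool
fsubFun a i b with b ≟ a
... | yes _ = inj₂ i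
... | no _ = inj₁ b

fsub : ∀ A a i → Hom A (remove A a)
fsub A a i = record { fun = fsubFun a i ; into = fin ; inj = finj }
  where
  fin : ∀ b → b ∈ₛ A → ∀ c → fsubFun a i b ≡ inj₁ c → c ∈ₛ remove A a
  fin b h c eq with b ≟ a
  fin b h c () | yes _
  fin b h .b refl | no ne = remove-keeps A a b h ne

  finj : ∀ b b' c → b ∈ₛ A → b' ∈ₛ A → fsubFun a i b ≡ inj₁ c → fsubFun a i b' ≡ inj₁ c → b ≡ b'
  finj b b' c h h' eq eq' with b ≟ a | b' ≟ a
  finj b b' c h h' () eq' | yes _ | _
  finj b b' c h h' eq () | no _ | yes _
  finj b b' c h h' refl eq' | no _ | no _ = sym (inj₁-injective eq')

record Functor : Set₁ where
  field
    obj    : FinSub → Set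
    hom    : ∀ {A B} → Hom A B → obj A → obj B
    hom-resp : ∀ {A B} (f g : Hom A B) → f ≈H g → ∀ x → hom f x ≡ hom g x
    hom-id : ∀ A x → hom (idH A) x ≡ x
    hom-∘  : ∀ {A B C} (g : Hom B C) (f : Hom A B) x → hom (g ∘H f) x ≡ hom g (hom f x)
open Functor public

record NatTrans (F F' : Functor) : Set where
  field
    η       : ∀ A → obj F A → obj F' A
    natural : ∀ {A B} (f : Hom A B) x → η B (hom F f x) ≡ hom F' f (η A x)
open NatTrans public

-- Nominal sets with 01-substitution.  Since Agda has no quotients, the
-- underlying set is a setoid (Carrier, _≈_); all equations are up to _≈_.

record Raw01 : Set₁ where
  field
    Carrier : Set
    _≈_     : Rel Carrier 0ℓ
    act     : Perm → Carrier → Carrier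
    sub     : Carrier → Name → Bool → Carrier

module _ (X : Raw01) where
  open Raw01 X

  Supports : List Name → Carrier → Set
  Supports A x = ∀ p → (∀ a → a ∈ A → ⟦ p ⟧ a ≡ a) → act p x ≈ x

  -- a # x  iff  a ∉ supp x  iff  some finite support of x omits a
  Fresh : Name → Carrier → Set
  Fresh a x = Σ (List Name) λ A → Supports A x × ¬ (a ∈ A)

  -- the axioms making X an object of 01Sub (documentation; I*F satisfies
  -- them by an earlier result of the paper)
  record Is01Sub : Set where
    field
      isEquivalence : IsEquivalence _≈_
      act-resp  : ∀ p {x y} → x ≈ y → act p x ≈ act p y
      act-ext   : ∀ p q → (∀ a → ⟦ p ⟧ a ≡ ⟦ q ⟧ a) → ∀ x → act p x ≈ act q x
      act-id    : ∀ x → act idP x ≈ x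
      act-∘     : ∀ p q x → act (p ∘P q) x ≈ act p (act q x)
      supported : ∀ x → Σ (List Name) λ A → Supports A x
      sub-resp  : ∀ {x y} a i → x ≈ y → sub x a i ≈ sub y a i
      sub-equiv : ∀ p x a i → act p (sub x a i) ≈ sub (act p x) (⟦ p ⟧ a) i
      sub-i     : ∀ x a i → Fresh a (sub x a i)
      sub-ii    : ∀ x a i → Fresh a x → sub x a i ≈ x
      sub-iii   : ∀ x a a' i i' → a ≢ a' → sub (sub x a i) a' i' ≈ sub (sub x a' i') a i

record Hom01 (X Y : Raw01) : Set where
  private
    module X = Raw01 X
    module Y = Raw01 Y
  field
    fn    : X.Carrier → Y.Carrier
    resp  : ∀ {x y} → x X.≈ y → fn x Y.≈ fn y
    equiv : ∀ p x → fn (X.act p x) Y.≈ Y.act p (fn x)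
    subst-pres : ∀ x a i → fn (X.sub x a i) Y.≈ Y.sub (fn x) a i
open Hom01 public

I* : Functor → Raw01
I* F = record
  { Carrier = Σ FinSub (obj F)
  ; _≈_ = λ { (A , x) (A' , x') →
        Σ FinSub λ B → Σ (A ⊆ₛ B) λ p → Σ (A' ⊆ₛ B) λ p' →
          hom F (incl {A} {B} p) x ≡ hom F (incl {A'} {B} p') x' }
  ; act = λ { p (A , x) → image p A , hom F (restrict p A) x }
  ; sub = λ { (A , x) a i → remove A a , hom F (fsub A a i) x }
  }

I*₁ : ∀ {F F'} → NatTrans F F' → Raw01.Carrier (I* F) → Raw01.Carrier (I* F')
I*₁ φ (A , x) = A , η φ A x

-- Every morphism f : A → B of 𝒞 agrees on A with the composite of a word of
-- substitutions f_{-,a,i} and permutations π|_-, and evaluating that word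
-- on [A , x] in I*F yields [B , F f x].  A morphism g of 01Sub commutes with
-- substitutions and permutations, hence with words.  Put φ_A x to be the
-- A-component of g [A , x], read off along the morphism keeping A and sending
-- all other names to 0.  A word that fixes A and kills all other names fixes
-- [A , x], so it fixes g [A , x] too, which gives g [A , x] = [A , φ_A x];
-- naturality of φ follows by pushing g through the word realising f.
module Submission where

open import Level using (0ℓ)
open import Defs
open import Data.Bool using (Bool; true; false; _∨_; if_then_else_)
open import Data.Bool.Properties using (∨-zeroʳ)
open import Data.Nat using (ℕ; zero; suc; _+_; _<_; _≤_; z≤n; s≤s; _≟_)
open import Data.Nat.Properties
  using (m<1+n⇒m<n∨m≡n; <⇒≢; >⇒≢; n<1+n; m<n⇒m<1+n; <-≤-trans; m≤m+n; m≤n+m; ≤-trans; +-cancelˡ-≡)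
open import Data.List using (List; []; _∷_; _++_; length)
open import Data.List.Relation.Unary.Any using (here; there)
open import Data.Product using (Σ; _×_; _,_; proj₁; proj₂)
open import Data.Sum using (_⊎_; inj₁; inj₂)
open import Data.Sum.Properties using (inj₁-injective)
open import Data.Empty using (⊥-elim)
open import Function using (_∘_; case_of_)
open import Relation.Nullary using (yes; no)
open import Relation.Binary using (IsEquivalence; Setoid)
open import Relation.Binary.PropositionalEquality
  using (_≡_; _≢_; refl; sym; trans; cong; subst; ≢-sym; module ≡-Reasoning)
import Relation.Binary.Reasoning.Setoid as SetoidReasoning

_∨ᵇ_ : List Bool → List Bool → List Bool
[] ∨ᵇ l' = l'
(b ∷ l) ∨ᵇ [] = b ∷ l
(b ∷ l) ∨ᵇ (c ∷ l') = (b ∨ c) ∷ (l ∨ᵇ l')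

mem-∨ᵇˡ : ∀ l l' n → mem l n ≡ true → mem (l ∨ᵇ l') n ≡ true
mem-∨ᵇˡ (b ∷ l) [] n h = h
mem-∨ᵇˡ (true ∷ l) (c ∷ l') zero h = refl
mem-∨ᵇˡ (b ∷ l) (c ∷ l') (suc n) h = mem-∨ᵇˡ l l' n h

mem-∨ᵇʳ : ∀ l l' n → mem l' n ≡ true → mem (l ∨ᵇ l') n ≡ true
mem-∨ᵇʳ [] l' n h = h
mem-∨ᵇʳ (b ∷ l) (true ∷ l') zero h = ∨-zeroʳ b
mem-∨ᵇʳ (b ∷ l) (c ∷ l') (suc n) h = mem-∨ᵇʳ l l' n h

_∪_ : FinSub → FinSub → FinSub
A ∪ B = mkFS (bits A ∨ᵇ bits B)

⊆-∪ˡ : ∀ A B → A ⊆ₛ (A ∪ B)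
⊆-∪ˡ A B a h = trans (mem-trim (bits A ∨ᵇ bits B) a) (mem-∨ᵇˡ (bits A) (bits B) a h)

⊆-∪ʳ : ∀ A B → B ⊆ₛ (A ∪ B)
⊆-∪ʳ A B a h = trans (mem-trim (bits A ∨ᵇ bits B) a) (mem-∨ᵇʳ (bits A) (bits B) a h)

record IsCongruence (X : Raw01) : Set where
  open Raw01 X
  field
    isEquivalence : IsEquivalence _≈_
    act-resp      : ∀ p {x y} → x ≈ y → act p x ≈ act p y
    sub-resp      : ∀ {x y} a i → x ≈ y → sub x a i ≈ sub y a i

module _ (F : Functor) where
  open Raw01 (I* F) using (_≈_)

  hom-incl-∘ : ∀ {A B E} (p : A ⊆ₛ B) (q : B ⊆ₛ E) (r : A ⊆ₛ E) x
             → hom F (incl {A} {E} r) x ≡ hom F (incl {B} {E} q) (hom F (incl {A} {B} p) x)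
  hom-incl-∘ p q r x =
    trans (hom-resp F (incl r) (incl q ∘H incl p) (λ _ _ → refl) x) (hom-∘ F (incl q) (incl p) x)

  I*-isEquivalence : IsEquivalence _≈_
  I*-isEquivalence = record { refl = ≈-refl ; sym = ≈-sym ; trans = ≈-trans }
    where
    ≈-refl : ∀ {z} → z ≈ z
    ≈-refl {A , x} = A , (λ _ h → h) , (λ _ h → h) , refl

    ≈-sym : ∀ {z z'} → z ≈ z' → z' ≈ z
    ≈-sym {_ , _} {_ , _} (B , p , p' , e) = B , p' , p , sym e

    ≈-trans : ∀ {z₁ z₂ z₃} → z₁ ≈ z₂ → z₂ ≈ z₃ → z₁ ≈ z₃
    ≈-trans {A₁ , x₁} {A₂ , x₂} {A₃ , x₃} (B , p₁ , p₂ , e) (B' , q₂ , q₃ , e') =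
      B ∪ B' , r₁ , r₃ , (begin
        hom F (incl r₁) x₁                   ≡⟨ hom-incl-∘ p₁ l r₁ x₁ ⟩
        hom F (incl l) (hom F (incl p₁) x₁)  ≡⟨ cong (hom F (incl l)) e ⟩
        hom F (incl l) (hom F (incl p₂) x₂)  ≡⟨ hom-incl-∘ p₂ l r₂ x₂ ⟨
        hom F (incl r₂) x₂                   ≡⟨ hom-incl-∘ q₂ r r₂ x₂ ⟩
        hom F (incl r) (hom F (incl q₂) x₂)  ≡⟨ cong (hom F (incl r)) e' ⟩
        hom F (incl r) (hom F (incl q₃) x₃)  ≡⟨ hom-incl-∘ q₃ r r₃ x₃ ⟨
        hom F (incl r₃) x₃                   ∎)
      where
      open ≡-Reasoning
      l : B ⊆ₛ (B ∪ B')
      l = ⊆-∪ˡ B B'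
      r : B' ⊆ₛ (B ∪ B')
      r = ⊆-∪ʳ B B'
      r₁ : A₁ ⊆ₛ (B ∪ B')
      r₁ a h = l a (p₁ a h)
      r₂ : A₂ ⊆ₛ (B ∪ B')
      r₂ a h = l a (p₂ a h)
      r₃ : A₃ ⊆ₛ (B ∪ B')
      r₃ a h = r a (q₃ a h)

  I*-setoid : Setoid 0ℓ 0ℓ
  I*-setoid = record { isEquivalence = I*-isEquivalence }

  hom-agree-≈ : ∀ {A B B'} (f : Hom A B) (h : Hom A B') → (∀ a → a ∈ₛ A → fun f a ≡ fun h a)
              → ∀ x → (B , hom F f x) ≈ (B' , hom F h x)
  hom-agree-≈ {A} {B} {B'} f h f≈h x = B ∪ B' , l , r , (begin
    hom F (incl l) (hom F f x)  ≡⟨ hom-∘ F (incl l) f x ⟨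
    hom F (incl l ∘H f) x       ≡⟨ hom-resp F (incl l ∘H f) (incl r ∘H h) agree x ⟩
    hom F (incl r ∘H h) x       ≡⟨ hom-∘ F (incl r) h x ⟩
    hom F (incl r) (hom F h x)  ∎)
    where
    open ≡-Reasoning
    l : B ⊆ₛ (B ∪ B')
    l = ⊆-∪ˡ B B'
    r : B' ⊆ₛ (B ∪ B')
    r = ⊆-∪ʳ B B'
    bind-inj₁ : ∀ y → bind inj₁ y ≡ y
    bind-inj₁ (inj₁ b) = refl
    bind-inj₁ (inj₂ i) = refl
    agree : (incl {B} {B ∪ B'} l ∘H f) ≈H (incl {B'} {B ∪ B'} r ∘H h)
    agree a ha = trans (bind-inj₁ (fun f a)) (trans (f≈h a ha) (sym (bind-inj₁ (fun h a))))

  hom-cong-≈ : ∀ {A A' B B' E D} (k : Hom A B) (k' : Hom A' B') (m : Hom E D)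
             → (∀ a → a ∈ₛ A → fun k a ≡ fun m a) → (∀ a → a ∈ₛ A' → fun k' a ≡ fun m a)
             → ∀ x x' (p : A ⊆ₛ E) (p' : A' ⊆ₛ E) → hom F (incl p) x ≡ hom F (incl p') x'
             → (B , hom F k x) ≈ (B' , hom F k' x')
  hom-cong-≈ {D = D} k k' m k≈m k'≈m x x' p p' e = begin
    (_ , hom F k x)                     ≈⟨ hom-agree-≈ k (m ∘H incl p) k≈m x ⟩
    (D , hom F (m ∘H incl p) x)         ≡⟨ cong (D ,_) (hom-∘ F m (incl p) x) ⟩
    (D , hom F m (hom F (incl p) x))    ≡⟨ cong (λ y → D , hom F m y) e ⟩
    (D , hom F m (hom F (incl p') x'))  ≡⟨ cong (D ,_) (hom-∘ F m (incl p') x') ⟨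
    (D , hom F (m ∘H incl p') x')       ≈⟨ hom-agree-≈ k' (m ∘H incl p') k'≈m x' ⟨
    (_ , hom F k' x')                   ∎
    where open SetoidReasoning I*-setoid

  I*-congruence : IsCongruence (I* F)
  I*-congruence = record
    { isEquivalence = I*-isEquivalence
    ; act-resp = λ { π {A , x} {A' , x'} (E , p , p' , e) →
        hom-cong-≈ (restrict π A) (restrict π A') (restrict π E) (λ _ _ → refl) (λ _ _ → refl) x x' p p' e }
    ; sub-resp = λ { {A , x} {A' , x'} a i (E , p , p' , e) →
        hom-cong-≈ (fsub A a i) (fsub A' a i) (fsub E a i) (λ _ _ → refl) (λ _ _ → refl) x x' p p' e }
    }

data Op : Set where
  _≔_  : Name → Bool → Op
  perm : Perm → Op

Word : Set
Word = List Op

eval : (X : Raw01) → Word → Raw01.Carrier X → Raw01.Carrier X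
eval X [] z = z
eval X ((a ≔ i) ∷ w) z = eval X w (Raw01.sub X z a i)
eval X (perm π ∷ w) z = eval X w (Raw01.act X π z)

module _ {X : Raw01} (cong-X : IsCongruence X) where
  open Raw01 X
  open IsCongruence cong-X
  open IsEquivalence isEquivalence using () renaming (refl to ≈-refl; trans to ≈-trans)

  eval-resp : ∀ w {z z'} → z ≈ z' → eval X w z ≈ eval X w z'
  eval-resp [] z≈z' = z≈z'
  eval-resp ((a ≔ i) ∷ w) z≈z' = eval-resp w (sub-resp a i z≈z')
  eval-resp (perm π ∷ w) z≈z' = eval-resp w (act-resp π z≈z')

  fn-eval : ∀ {W} (g : Hom01 W X) w z → fn g (eval W w z) ≈ eval X w (fn g z)
  fn-eval g [] z = ≈-refl
  fn-eval {W} g ((a ≔ i) ∷ w) z = ≈-trans (fn-eval g w (Raw01.sub W z a i)) (eval-resp w (subst-pres g z a i))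
  fn-eval {W} g (perm π ∷ w) z = ≈-trans (fn-eval g w (Raw01.act W π z)) (eval-resp w (equiv g π z))

wordFun : Word → Name → Name ⊎ Bool
wordFun [] x = inj₁ x
wordFun ((a ≔ i) ∷ w) x = bind (wordFun w) (fsubFun a i x)
wordFun (perm π ∷ w) x = wordFun w (⟦ π ⟧ x)

wordFun-++ : ∀ w₁ w₂ x → wordFun (w₁ ++ w₂) x ≡ bind (wordFun w₂) (wordFun w₁ x)
wordFun-++ [] w₂ x = refl
wordFun-++ ((a ≔ i) ∷ w₁) w₂ x with fsubFun a i x
... | inj₁ y = wordFun-++ w₁ w₂ y
... | inj₂ j = refl
wordFun-++ (perm π ∷ w₁) w₂ x = wordFun-++ w₁ w₂ (⟦ π ⟧ x)

wordCod : Word → FinSub → FinSub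
wordCod [] A = A
wordCod ((a ≔ i) ∷ w) A = wordCod w (remove A a)
wordCod (perm π ∷ w) A = wordCod w (image π A)

wordHom : ∀ w A → Hom A (wordCod w A)
wordHom [] A = idH A
wordHom ((a ≔ i) ∷ w) A = wordHom w (remove A a) ∘H fsub A a i
wordHom (perm π ∷ w) A = wordHom w (image π A) ∘H restrict π A

fun-wordHom : ∀ w A a → a ∈ₛ A → fun (wordHom w A) a ≡ wordFun w a
fun-wordHom [] A a h = refl
fun-wordHom ((b ≔ i) ∷ w) A a h with fsubFun b i a in eq
... | inj₁ c = fun-wordHom w (remove A b) c (into (fsub A b i) a h c eq)
... | inj₂ j = refl
fun-wordHom (perm π ∷ w) A a h = fun-wordHom w (image π A) (⟦ π ⟧ a) (image-∈ π A a h)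

_realises_on_ : Word → (Name → Name ⊎ Bool) → FinSub → Set
w realises h on A = ∀ a → a ∈ₛ A → wordFun w a ≡ h a

module _ (F : Functor) where
  open Raw01 (I* F) using (_≈_)

  eval-I* : ∀ w A x → eval (I* F) w (A , x) ≡ (wordCod w A , hom F (wordHom w A) x)
  eval-I* [] A x = cong (A ,_) (sym (hom-id F A x))
  eval-I* ((a ≔ i) ∷ w) A x =
    trans (eval-I* w (remove A a) (hom F (fsub A a i) x))
          (cong (wordCod w (remove A a) ,_) (sym (hom-∘ F (wordHom w (remove A a)) (fsub A a i) x)))
  eval-I* (perm π ∷ w) A x =
    trans (eval-I* w (image π A) (hom F (restrict π A) x))
          (cong (wordCod w (image π A) ,_) (sym (hom-∘ F (wordHom w (image π A)) (restrict π A) x)))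

  eval-realising : ∀ {A B} (f : Hom A B) w → w realises fun f on A
                 → ∀ x → eval (I* F) w (A , x) ≈ (B , hom F f x)
  eval-realising {A} f w w-f x rewrite eval-I* w A x =
    hom-agree-≈ F (wordHom w A) f (λ a h → trans (fun-wordHom w A a h) (w-f a h)) x

fsubFun-other : ∀ a i b → b ≢ a → fsubFun a i b ≡ inj₁ b
fsubFun-other a i b b≢a with b ≟ a
... | yes b≡a = ⊥-elim (b≢a b≡a)
... | no _ = refl

fsubFun-self : ∀ a i → fsubFun a i a ≡ inj₂ i
fsubFun-self a i with a ≟ a
... | yes _ = refl
... | no a≢a = ⊥-elim (a≢a refl)

mem-bound : ∀ l n → mem l n ≡ true → n < length l
mem-bound (b ∷ l) zero h = s≤s z≤n
mem-bound (b ∷ l) (suc n) h = s≤s (mem-bound l n h)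

swap : Name × Name → Name → Name
swap (u , v) x with x ≟ u | x ≟ v
... | yes _ | _ = v
... | no _ | yes _ = u
... | no _ | no _ = x

Avoids : Name → Name × Name → Set
Avoids x (u , v) = x ≢ u × x ≢ v

swap-fst : ∀ u v → swap (u , v) u ≡ v
swap-fst u v with u ≟ u
... | yes _ = refl
... | no u≢u = ⊥-elim (u≢u refl)

swap-snd : ∀ u v → swap (u , v) v ≡ u
swap-snd u v with v ≟ u | v ≟ v
... | yes v≡u | _ = v≡u
... | no _ | yes _ = refl
... | no _ | no v≢v = ⊥-elim (v≢v refl)

swap-avoiding : ∀ {x} uv → Avoids x uv → swap uv x ≡ x
swap-avoiding {x} (u , v) (x≢u , x≢v) with x ≟ u | x ≟ v
... | yes x≡u | _ = ⊥-elim (x≢u x≡u)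
... | no _ | yes x≡v = ⊥-elim (x≢v x≡v)
... | no _ | no _ = refl

swap-involutive : ∀ uv x → swap uv (swap uv x) ≡ x
swap-involutive (u , v) x with x ≟ u | x ≟ v
... | yes refl | _ = swap-snd u v
... | no _ | yes refl = swap-fst u v
... | no x≢u | no x≢v = swap-avoiding (u , v) (x≢u , x≢v)

swapPerm : Name × Name → Perm
swapPerm (u , v) = record
  { π = swap (u , v) ; π⁻¹ = swap (u , v)
  ; left = swap-involutive (u , v) ; right = swap-involutive (u , v)
  ; moved = u ∷ v ∷ []
  ; finite = λ a a∉ → swap-avoiding (u , v) ((λ e → a∉ (here e)) , (λ e → a∉ (there (here e))))
  }

-- swaps s m performs the swaps s (m - 1), …, s 1, s 0 in this order.
swaps : (ℕ → Name × Name) → ℕ → Word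
swaps s zero = []
swaps s (suc m) = perm (swapPerm (s m)) ∷ swaps s m

swaps-fixes : ∀ s m x → (∀ k → k < m → Avoids x (s k)) → wordFun (swaps s m) x ≡ inj₁ x
swaps-fixes s zero x avoid = refl
swaps-fixes s (suc m) x avoid rewrite swap-avoiding (s m) (avoid m (n<1+n m)) =
  swaps-fixes s m x (λ k k<m → avoid k (m<n⇒m<1+n k<m))

swaps-moves : ∀ s m n x → n < m
            → (∀ k → k < m → k ≢ n → Avoids x (s k) × Avoids (swap (s n) x) (s k))
            → wordFun (swaps s m) x ≡ inj₁ (swap (s n) x)
swaps-moves s (suc m) n x n<1+m avoid with m<1+n⇒m<n∨m≡n n<1+m
... | inj₂ refl = swaps-fixes s n (swap (s n) x) (λ k k<n → proj₂ (avoid k (m<n⇒m<1+n k<n) (<⇒≢ k<n)))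
... | inj₁ n<m rewrite swap-avoiding (s m) (proj₁ (avoid m (n<1+n m) (>⇒≢ n<m))) =
  swaps-moves s m n x n<m (λ k k<m → avoid k (m<n⇒m<1+n k<m))

-- Every name of A is below N, and every name from M on is fresh for A and B.
-- The constants are substituted first.  Then each a < N is moved out of
-- the way to the fresh name M + a and from there to its image, so that no
-- swap disturbs a name that has already been placed.
module Realiser {A B : FinSub} (f : Hom A B) where
  N M : ℕ
  N = length (bits A)
  M = N + length (bits B)

  constSubs : ℕ → Word
  constSubs zero = []
  constSubs (suc n) with mem (bits A) n | fun f n
  ... | true | inj₂ i = (n ≔ i) ∷ constSubs n
  ... | _    | _      = constSubs n

  constSubs-keeps : ∀ m a b → fun f a ≡ inj₁ b → wordFun (constSubs m) a ≡ inj₁ a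
  constSubs-keeps zero a b fa≡b = refl
  constSubs-keeps (suc n) a b fa≡b with mem (bits A) n | fun f n in fn≡
  ... | true  | inj₁ _ = constSubs-keeps n a b fa≡b
  ... | false | _      = constSubs-keeps n a b fa≡b
  ... | true  | inj₂ i rewrite fsubFun-other n i a (λ { refl → case trans (sym fa≡b) fn≡ of λ () }) =
    constSubs-keeps n a b fa≡b

  constSubs-sends : ∀ m a i → a ∈ₛ A → fun f a ≡ inj₂ i → a < m → wordFun (constSubs m) a ≡ inj₂ i
  constSubs-sends (suc n) a i a∈A fa≡i a<1+n with m<1+n⇒m<n∨m≡n a<1+n
  ... | inj₂ refl rewrite a∈A | fa≡i | fsubFun-self a i = refl
  ... | inj₁ a<n with mem (bits A) n | fun f n
  ...   | true  | inj₁ _ = constSubs-sends n a i a∈A fa≡i a<n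
  ...   | false | _      = constSubs-sends n a i a∈A fa≡i a<n
  ...   | true  | inj₂ j rewrite fsubFun-other n j a (<⇒≢ a<n) = constSubs-sends n a i a∈A fa≡i a<n

  target : Name → Name
  target n with mem (bits A) n | fun f n
  ... | true | inj₁ b = b
  ... | _    | _      = M + n

  target-image : ∀ n b → n ∈ₛ A → fun f n ≡ inj₁ b → target n ≡ b
  target-image n b n∈A fn≡b rewrite n∈A | fn≡b = refl

  target-cases : ∀ n → (target n ≡ M + n) ⊎ (n ∈ₛ A × fun f n ≡ inj₁ (target n))
  target-cases n with mem (bits A) n | fun f n
  ... | true  | inj₁ b = inj₂ (refl , refl)
  ... | true  | inj₂ _ = inj₁ refl
  ... | false | _      = inj₁ refl

  <M-in-B : ∀ b → b ∈ₛ B → b < M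
  <M-in-B b b∈B = <-≤-trans (mem-bound (bits B) b b∈B) (m≤n+m (length (bits B)) N)

  N≤M : N ≤ M
  N≤M = m≤m+n N (length (bits B))

  <M-in-A : ∀ a → a ∈ₛ A → a < M
  <M-in-A a a∈A = <-≤-trans (mem-bound (bits A) a a∈A) N≤M

  shiftOut shiftIn : ℕ → Name × Name
  shiftOut n = n , M + n
  shiftIn n = M + n , target n

  shiftOut-moves : ∀ a → a ∈ₛ A → wordFun (swaps shiftOut N) a ≡ inj₁ (M + a)
  shiftOut-moves a a∈A =
    trans (swaps-moves shiftOut N a a (mem-bound (bits A) a a∈A) avoid) (cong inj₁ (swap-fst a (M + a)))
    where
    avoid : ∀ k → k < N → k ≢ a → Avoids a (shiftOut k) × Avoids (swap (shiftOut a) a) (shiftOut k)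
    avoid k k<N k≢a rewrite swap-fst a (M + a) =
      (≢-sym k≢a , <⇒≢ (<-≤-trans (<M-in-A a a∈A) (m≤m+n M k))) ,
      (>⇒≢ (<-≤-trans k<N (≤-trans N≤M (m≤m+n M a))) , k≢a ∘ sym ∘ +-cancelˡ-≡ M a k)

  shiftIn-moves : ∀ a b → a ∈ₛ A → fun f a ≡ inj₁ b → wordFun (swaps shiftIn N) (M + a) ≡ inj₁ b
  shiftIn-moves a b a∈A fa≡b =
    trans (swaps-moves shiftIn N a (M + a) (mem-bound (bits A) a a∈A) avoid)
          (cong inj₁ (trans (swap-fst (M + a) (target a)) (target-image a b a∈A fa≡b)))
    where
    b<M : b < M
    b<M = <M-in-B b (into f a a∈A b fa≡b)
    avoid : ∀ k → k < N → k ≢ a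
          → Avoids (M + a) (shiftIn k) × Avoids (swap (shiftIn a) (M + a)) (shiftIn k)
    avoid k _ k≢a rewrite swap-fst (M + a) (target a) | target-image a b a∈A fa≡b =
      (M+a≢M+k , M+a≢target) , (<⇒≢ (<-≤-trans b<M (m≤m+n M k)) , b≢target)
      where
      M+a≢M+k : M + a ≢ M + k
      M+a≢M+k = k≢a ∘ sym ∘ +-cancelˡ-≡ M a k
      M+a≢target : M + a ≢ target k
      M+a≢target e with target-cases k
      ... | inj₁ tk≡ = M+a≢M+k (trans e tk≡)
      ... | inj₂ (k∈A , fk≡) =
        <⇒≢ (<-≤-trans (<M-in-B (target k) (into f k k∈A (target k) fk≡)) (m≤m+n M a)) (sym e)
      b≢target : b ≢ target k
      b≢target e with target-cases k
      ... | inj₁ tk≡ = <⇒≢ (<-≤-trans b<M (m≤m+n M k)) (trans e tk≡)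
      ... | inj₂ (k∈A , fk≡) = k≢a (inj f k a b k∈A a∈A (trans fk≡ (cong inj₁ (sym e))) fa≡b)

  word : Word
  word = constSubs N ++ swaps shiftOut N ++ swaps shiftIn N

  word-realises : word realises fun f on A
  word-realises a a∈A with fun f a in fa≡
  ... | inj₁ b = begin
    wordFun word a
      ≡⟨ wordFun-++ (constSubs N) _ a ⟩
    bind (wordFun (swaps shiftOut N ++ swaps shiftIn N)) (wordFun (constSubs N) a)
      ≡⟨ cong (bind _) (constSubs-keeps N a b fa≡) ⟩
    wordFun (swaps shiftOut N ++ swaps shiftIn N) a
      ≡⟨ wordFun-++ (swaps shiftOut N) _ a ⟩
    bind (wordFun (swaps shiftIn N)) (wordFun (swaps shiftOut N) a)
      ≡⟨ cong (bind _) (shiftOut-moves a a∈A) ⟩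
    wordFun (swaps shiftIn N) (M + a)
      ≡⟨ shiftIn-moves a b a∈A fa≡ ⟩
    inj₁ b ∎
    where open ≡-Reasoning
  ... | inj₂ i = trans (wordFun-++ (constSubs N) _ a)
                       (cong (bind _) (constSubs-sends N a i a∈A fa≡ (mem-bound (bits A) a a∈A)))

keepIn : FinSub → Name → Name ⊎ Bool
keepIn B c = if mem (bits B) c then inj₁ c else inj₂ false

keepIn-self : ∀ B b → b ∈ₛ B → keepIn B b ≡ inj₁ b
keepIn-self B b b∈B rewrite b∈B = refl

keepIn-inj₁ : ∀ B c b → keepIn B c ≡ inj₁ b → c ∈ₛ B × c ≡ b
keepIn-inj₁ B c b e with mem (bits B) c
... | true  = refl , inj₁-injective e
... | false = case e of λ ()

-- Any constant would do for the names outside B.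
project : ∀ C B → Hom C B
project C B = record
  { fun = keepIn B
  ; into = λ c _ b e → subst (_∈ₛ B) (proj₂ (keepIn-inj₁ B c b e)) (proj₁ (keepIn-inj₁ B c b e))
  ; inj = λ c c' b _ _ e e' → trans (proj₂ (keepIn-inj₁ B c b e)) (sym (proj₂ (keepIn-inj₁ B c' b e')))
  }

module _ (F : Functor) where
  open Raw01 (I* F) using (Carrier; _≈_)

  projection : ∀ B → Carrier → obj F B
  projection B (C , v) = hom F (project C B) v

  projection-resp : ∀ B {z z'} → z ≈ z' → projection B z ≡ projection B z'
  projection-resp B {C , v} {D , v'} (E , p , p' , e) = begin
    hom F (project C B) v                       ≡⟨ hom-resp F _ (project E B ∘H incl p) (λ _ _ → refl) v ⟩
    hom F (project E B ∘H incl p) v             ≡⟨ hom-∘ F (project E B) (incl p) v ⟩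
    hom F (project E B) (hom F (incl p) v)      ≡⟨ cong (hom F (project E B)) e ⟩
    hom F (project E B) (hom F (incl p') v')    ≡⟨ hom-∘ F (project E B) (incl p') v' ⟨
    hom F (project E B ∘H incl p') v'           ≡⟨ hom-resp F _ (project E B ∘H incl p') (λ _ _ → refl) v' ⟨
    hom F (project D B) v'                      ∎
    where open ≡-Reasoning

  projection-self : ∀ B y → projection B (B , y) ≡ y
  projection-self B y = trans (hom-resp F (project B B) (idH B) (keepIn-self B) y) (hom-id F B y)

  eval-fixing : ∀ w A → w realises inj₁ on A → ∀ x → eval (I* F) w (A , x) ≈ (A , x)
  eval-fixing w A w-id x =
    subst (eval (I* F) w (A , x) ≈_) (cong (A ,_) (hom-id F A x)) (eval-realising F (idH A) w w-id x)

module FullnessWitness (F F' : Functor) (g : Hom01 (I* F) (I* F')) where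
  open Raw01 (I* F') using (_≈_)
  open SetoidReasoning (I*-setoid F')
  open IsEquivalence (I*-isEquivalence F) using () renaming (sym to ≈-sym)

  φ : ∀ A → obj F A → obj F' A
  φ A x = projection F' A (fn g (A , x))

  fn-supported : ∀ A x → (A , φ A x) ≈ fn g (A , x)
  fn-supported A x = begin
    (A , hom F' (project C A) v)      ≈⟨ eval-realising F' (project C A) word word-projects v ⟨
    eval (I* F') word (fn g (A , x))  ≈⟨ fn-eval (I*-congruence F') g word (A , x) ⟨
    fn g (eval (I* F) word (A , x))   ≈⟨ resp g (eval-fixing F word A word-fixes x) ⟩
    fn g (A , x)                      ∎
    where
    C : FinSub
    C = proj₁ (fn g (A , x))
    v : obj F' C
    v = proj₂ (fn g (A , x))
    open Realiser (project (A ∪ C) A) using (word; word-realises)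
    word-fixes : word realises inj₁ on A
    word-fixes a a∈A = trans (word-realises a (⊆-∪ˡ A C a a∈A)) (keepIn-self A a a∈A)
    word-projects : word realises keepIn A on C
    word-projects c c∈C = word-realises c (⊆-∪ʳ A C c c∈C)

  natural-φ : ∀ {A B} (f : Hom A B) x → φ B (hom F f x) ≡ hom F' f (φ A x)
  natural-φ {A} {B} f x = trans (projection-resp F' B fg≈) (projection-self F' B (hom F' f (φ A x)))
    where
    open Realiser f using (word; word-realises)
    fg≈ : fn g (B , hom F f x) ≈ (B , hom F' f (φ A x))
    fg≈ = begin
      fn g (B , hom F f x)              ≈⟨ resp g (≈-sym (eval-realising F f word word-realises x)) ⟩
      fn g (eval (I* F) word (A , x))    ≈⟨ fn-eval (I*-congruence F') g word (A , x) ⟩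
      eval (I* F') word (fn g (A , x))   ≈⟨ eval-resp (I*-congruence F') word (fn-supported A x) ⟨
      eval (I* F') word (A , φ A x)      ≈⟨ eval-realising F' f word word-realises (φ A x) ⟩
      (B , hom F' f (φ A x))             ∎

  φ-nat : NatTrans F F'
  φ-nat = record { η = φ ; natural = natural-φ }

lemma3 : (F F' : Functor) (g : Hom01 (I* F) (I* F'))
       → Σ (NatTrans F F') λ φ → ∀ p → Raw01._≈_ (I* F') (I*₁ φ p) (fn g p)
lemma3 F F' g = φ-nat , λ { (A , x) → fn-supported A x }
  where open FullnessWitness F F' g
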